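{- Let $\pi$ be a degree sequence of length $n$. Let $\kappa_1$ be the number of entries equal to $1$, and let $x = 1$ if no entry equals $2$ and $x = 0$ otherwise. If some good entry $d$ of $\pi$ satisfies $d > n - 1 - \kappa_1 - x$, then $\pi$ is ds-reconstruction-forcing.
   Context: All graphs are finite and simple. An entry (degree) $d$ of a degree sequence is bad if $d-1$ also occurs in the sequence; good means not bad. For a vertex $v$ of a graph $G$, $v$ is ds-completable if, for each integer $d$, the vertices having degree $d$ in $G-v$ are either all neighbours of $v$ in $G$ or all non-neighbours. A graph is ds-reconstructible if it has a ds-completable vertex; a degree sequence is ds-reconstruction-forcing if every graph realizing it is ds-reconstructible (non-graphic sequences are deemed forcing). -}

module Defs where

open import Data.Nat using (ℕ; zero; suc; _+_; _∸_; _≤_; _<_; _≡ᵇ_)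
open import Data.Bool using (Bool; true; false; _∧_; not; if_then_else_)
open import Data.Fin using (Fin; zero; suc; _≟_)
open import Data.Product using (Σ; _×_; ∃)
open import Data.Sum using (_⊎_)
open import Relation.Nullary using (¬_; ⌊_⌋)
open import Relation.Binary.PropositionalEquality using (_≡_)

count : {n : ℕ} → (Fin n → Bool) → ℕ
count {zero}  p = 0
count {suc n} p = (if p zero then 1 else 0) + count (λ i → p (suc i))

record Graph (n : ℕ) : Set where
  field
    adj   : Fin n → Fin n → Bool
    sym   : ∀ u v → adj u v ≡ adj v u
    irrefl : ∀ v → adj v v ≡ false
open Graph public

deg : {n : ℕ} → Graph n → Fin n → ℕ
deg G u = count (λ w → adj G u w)

-- degree of u (≠ v) in G - v : neighbours of u other than v
degDel : {n : ℕ} → Graph n → Fin n → Fin n → ℕ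
degDel G v u = count (λ w → adj G u w ∧ not ⌊ w ≟ v ⌋)

DsCompletable : {n : ℕ} → Graph n → Fin n → Set
DsCompletable G v =
  (d : ℕ) →
    (∀ u → ¬ (u ≡ v) → degDel G v u ≡ d → adj G v u ≡ true)
  ⊎ (∀ u → ¬ (u ≡ v) → degDel G v u ≡ d → adj G v u ≡ false)

DsReconstructible : {n : ℕ} → Graph n → Set
DsReconstructible G = ∃ λ v → DsCompletable G v

Realizes : {n : ℕ} → Graph n → (Fin n → ℕ) → Set
Realizes G π = ∀ i → deg G i ≡ π i

-- every realization is ds-reconstructible (vacuous if π not graphic)
DsReconstructionForcing : {n : ℕ} → (Fin n → ℕ) → Set
DsReconstructionForcing {n} π = (G : Graph n) → Realizes G π → DsReconstructible G

Occurs : {n : ℕ} → (Fin n → ℕ) → ℕ → Set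
Occurs π d = ∃ λ i → π i ≡ d

-- d is bad if d - 1 occurs (so 0 is never bad)
Bad : {n : ℕ} → (Fin n → ℕ) → ℕ → Set
Bad π d = Σ ℕ λ k → (suc k ≡ d) × Occurs π k

GoodEntry : {n : ℕ} → (Fin n → ℕ) → ℕ → Set
GoodEntry π d = Occurs π d × ¬ Bad π d

kappa1 : {n : ℕ} → (Fin n → ℕ) → ℕ
kappa1 π = count (λ i → π i ≡ᵇ 1)

xval : {n : ℕ} → (Fin n → ℕ) → ℕ
xval π = if count (λ i → π i ≡ᵇ 2) ≡ᵇ 0 then 1 else 0

module Submission where

-- Call a vertex v of a graph G *step-free* (for a labelling π of the vertices
-- by their degrees) if no neighbour of v has degree exactly one more than a
-- non-neighbour w ≠ v of v.  Deleting v lowers the degree of every neighbour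
-- by one and keeps the degree of every non-neighbour, so a step-free vertex
-- is ds-completable; it remains to find a step-free vertex in every
-- realization G of π.  Let v carry the good entry d.
--   * If v has a leaf neighbour ℓ, then ℓ is step-free: its only neighbour
--     is v, and π v = π w + 1 would make d bad.
--   * Otherwise v, its d neighbours, its leaf non-neighbours and its S
--     non-leaf non-neighbours partition the n vertices, while every leaf
--     other than v is a non-neighbour; so n ≤ d + κ₁ + x yields
--     1 + S ≤ [d = 1] + x.  If d = 0, v is isolated, hence step-free; if
--     d ≥ 2, then S = 0 and no entry is 2, which makes v step-free; if d = 1,
--     then S ≤ x ≤ 1 and the unique neighbour of v is step-free.

open import Defs hiding (sym)
open import Data.Nat using (ℕ; zero; suc; _+_; _≤_; _≡ᵇ_; z≤n; s≤s; s≤s⁻¹)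
import Data.Nat.Properties as ℕₚ
open ℕₚ using (≤-trans; ≤-reflexive; m≤n+m; n≤0⇒n≡0; +-suc; +-assoc; +-comm; +-cancelˡ-≤; +-monoʳ-≤; +-monoˡ-≤; ≡ᵇ⇒≡)
open import Data.Bool using (Bool; true; false; _∧_; not; if_then_else_)
import Data.Bool.Properties as Boolₚ
open Boolₚ using (∧-identityʳ; ∧-zeroʳ; ¬-not; T-≡)
open import Data.Fin using (Fin; zero; suc)
open import Data.Fin.Properties using (_≟_; any?)
open import Data.Product using (_×_; ∃; _,_)
open import Data.Sum using (inj₁; inj₂)
open import Data.Empty using (⊥)
open import Function using (_∘_; Equivalence)
open import Relation.Nullary using (¬_; yes; no; ⌊_⌋)
open import Relation.Nullary.Decidable using (_×-dec_; isYes≗does; dec-false)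
open import Relation.Binary.PropositionalEquality using (_≡_; refl; sym; trans; cong; cong₂; subst; module ≡-Reasoning)

private
  variable
    n : ℕ

∧-true : ∀ {a b} → a ∧ b ≡ true → a ≡ true × b ≡ true
∧-true {true} {true} _ = refl , refl

≡ᵇ-true⇒≡ : ∀ m k → (m ≡ᵇ k) ≡ true → m ≡ k
≡ᵇ-true⇒≡ m k e = ≡ᵇ⇒≡ m k (Equivalence.from T-≡ e)

⌊suc≟suc⌋ : (i v : Fin n) → ⌊ suc i ≟ suc v ⌋ ≡ ⌊ i ≟ v ⌋
⌊suc≟suc⌋ i v = trans (isYes≗does (suc i ≟ suc v)) (sym (isYes≗does (i ≟ v)))

⌊≟⌋-false : {i v : Fin n} → ¬ i ≡ v → ⌊ i ≟ v ⌋ ≡ false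
⌊≟⌋-false {i = i} {v} i≢v = trans (isYes≗does (i ≟ v)) (dec-false (i ≟ v) i≢v)

ind : Bool → ℕ
ind b = if b then 1 else 0

count-cong : {p q : Fin n → Bool} → (∀ i → p i ≡ q i) → count p ≡ count q
count-cong {zero}  eq = refl
count-cong {suc n} eq = cong₂ _+_ (cong ind (eq zero)) (count-cong (eq ∘ suc))

count-all : count {n} (λ _ → true) ≡ n
count-all {zero}  = refl
count-all {suc n} = cong suc (count-all {n})

count-split : (p q : Fin n → Bool) →
  count p ≡ count (λ i → p i ∧ q i) + count (λ i → p i ∧ not (q i))
count-split {zero} p q = refl
count-split {suc n} p q with p zero | q zero | count-split (p ∘ suc) (q ∘ suc)
... | true  | true  | ih = cong suc ih
... | true  | false | ih = trans (cong suc ih) (sym (+-suc _ _))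
... | false | true  | ih = ih
... | false | false | ih = ih

count-remove : (p : Fin n → Bool) (v : Fin n) →
  count (λ i → p i ∧ not ⌊ i ≟ v ⌋) + ind (p v) ≡ count p
count-remove {suc n} p zero = begin
  ind (p zero ∧ false) + count (λ i → p (suc i) ∧ true) + ind (p zero)
    ≡⟨ cong₂ (λ a c → ind a + c + ind (p zero))
             (∧-zeroʳ (p zero)) (count-cong (∧-identityʳ ∘ p ∘ suc)) ⟩
  count (p ∘ suc) + ind (p zero)
    ≡⟨ +-comm (count (p ∘ suc)) (ind (p zero)) ⟩
  count p ∎
  where open ≡-Reasoning
count-remove {suc n} p (suc v) = begin
  ind (p zero ∧ true) + count (λ i → p (suc i) ∧ not ⌊ suc i ≟ suc v ⌋) + ind (p (suc v))
    ≡⟨ cong₂ (λ a c → ind a + c + ind (p (suc v))) (∧-identityʳ (p zero))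
             (count-cong (λ i → cong (λ b → p (suc i) ∧ not b) (⌊suc≟suc⌋ i v))) ⟩
  ind (p zero) + count (λ i → p (suc i) ∧ not ⌊ i ≟ v ⌋) + ind (p (suc v))
    ≡⟨ +-assoc (ind (p zero)) _ _ ⟩
  ind (p zero) + (count (λ i → p (suc i) ∧ not ⌊ i ≟ v ⌋) + ind (p (suc v)))
    ≡⟨ cong (ind (p zero) +_) (count-remove (p ∘ suc) v) ⟩
  count p ∎
  where open ≡-Reasoning

count-mono : (p q : Fin n → Bool) → (∀ i → p i ≡ true → q i ≡ true) → count p ≤ count q
count-mono {zero} p q p⇒q = z≤n
count-mono {suc n} p q p⇒q with p zero in p0 | q zero in q0
... | true  | true  = s≤s (count-mono (p ∘ suc) (q ∘ suc) (p⇒q ∘ suc))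
... | true  | false with () ← trans (sym (p⇒q zero p0)) q0
... | false | true  = ℕₚ.m≤n⇒m≤1+n (count-mono (p ∘ suc) (q ∘ suc) (p⇒q ∘ suc))
... | false | false = count-mono (p ∘ suc) (q ∘ suc) (p⇒q ∘ suc)

count-pos : (p : Fin n → Bool) (i : Fin n) → p i ≡ true → 1 ≤ count p
count-pos p zero    pi rewrite pi = s≤s z≤n
count-pos p (suc i) pi = ≤-trans (count-pos (p ∘ suc) i pi) (m≤n+m _ (ind (p zero)))

count-two : (p : Fin n → Bool) (i j : Fin n) → p i ≡ true → p j ≡ true → ¬ i ≡ j → 2 ≤ count p
count-two p zero    zero    pi pj i≢j with () ← i≢j refl
count-two p zero    (suc j) pi pj i≢j rewrite pi = s≤s (count-pos (p ∘ suc) j pj)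
count-two p (suc i) zero    pi pj i≢j rewrite pj = s≤s (count-pos (p ∘ suc) i pi)
count-two p (suc i) (suc j) pi pj i≢j =
  ≤-trans (count-two (p ∘ suc) i j pi pj (i≢j ∘ cong suc)) (m≤n+m _ (ind (p zero)))

count-witness : (p : Fin n → Bool) → 1 ≤ count p → ∃ λ i → p i ≡ true
count-witness {suc n} p pos with p zero in p0
... | true  = zero , p0
... | false with (i , pi) ← count-witness (p ∘ suc) pos = suc i , pi

deg-split : (G : Graph n) (v u : Fin n) → deg G u ≡ degDel G v u + ind (adj G v u)
deg-split G v u = trans (sym (count-remove (adj G u) v))
                        (cong (λ b → degDel G v u + ind b) (Graph.sym G u v))

deg-of-nbr : (G : Graph n) (v u : Fin n) → adj G v u ≡ true → deg G u ≡ suc (degDel G v u)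
deg-of-nbr G v u vu = trans (deg-split G v u)
                            (trans (cong (λ b → degDel G v u + ind b) vu) (+-comm _ 1))

deg-of-nonNbr : (G : Graph n) (v u : Fin n) → adj G v u ≡ false → deg G u ≡ degDel G v u
deg-of-nonNbr G v u vu = trans (deg-split G v u)
                               (trans (cong (λ b → degDel G v u + ind b) vu) (ℕₚ.+-identityʳ _))

adj⇒≢ : (G : Graph n) {u v : Fin n} → adj G u v ≡ true → ¬ v ≡ u
adj⇒≢ G {u} uv refl with () ← trans (sym uv) (irrefl G u)

leaf-nbr : (G : Graph n) {π : Fin n → ℕ} → Realizes G π → (v : Fin n) → π v ≡ 1 →
  ∃ λ p → adj G v p ≡ true
leaf-nbr G real v leaf = count-witness (adj G v) (≤-reflexive (sym (trans (real v) leaf)))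

leaf-unique-nbr : (G : Graph n) {π : Fin n → ℕ} → Realizes G π → {v a b : Fin n} →
  π v ≡ 1 → adj G v a ≡ true → adj G v b ≡ true → a ≡ b
leaf-unique-nbr G real {v} {a} {b} leaf va vb with a ≟ b
... | yes a≡b = a≡b
... | no a≢b with s≤s () ← subst (2 ≤_) (trans (real v) leaf) (count-two (adj G v) a b va vb a≢b)

StepFree : Graph n → (Fin n → ℕ) → Fin n → Set
StepFree G π v =
  ∀ u w → adj G v u ≡ true → adj G v w ≡ false → ¬ w ≡ v → π u ≡ suc (π w) → ⊥

-- Vertices of G - v with a common degree d are all neighbours of v unless
-- some neighbour u and non-neighbour w share it, which means π u = π w + 1.
stepFree⇒completable : (G : Graph n) (π : Fin n → ℕ) (v : Fin n) →
  Realizes G π → StepFree G π v → DsCompletable G v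
stepFree⇒completable G π v real free d
  with any? (λ u → (adj G v u Boolₚ.≟ true) ×-dec (degDel G v u ℕₚ.≟ d))
... | yes (u , vu , u↦d) = inj₁ λ w w≢v w↦d → ¬-not {y = false} λ vw →
  free u w vu vw w≢v (begin
    π u                   ≡⟨ sym (real u) ⟩
    deg G u               ≡⟨ deg-of-nbr G v u vu ⟩
    suc (degDel G v u)    ≡⟨ cong suc (trans u↦d (sym w↦d)) ⟩
    suc (degDel G v w)    ≡⟨ cong suc (sym (deg-of-nonNbr G v w vw)) ⟩
    suc (deg G w)         ≡⟨ cong suc (real w) ⟩
    suc (π w)             ∎)
  where open ≡-Reasoning
... | no none = inj₂ λ w _ w↦d → ¬-not {y = true} λ vw → none (w , vw , w↦d)

bad-step : {π : Fin n → ℕ} {u : Fin n} (w : Fin n) → π u ≡ suc (π w) → Bad π (π u)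
bad-step {π = π} w step = π w , sym step , w , refl

step⇒≢ : {π : Fin n → ℕ} {u w : Fin n} → π u ≡ suc (π w) → ¬ u ≡ w
step⇒≢ step refl = ℕₚ.1+n≢n (sym step)

isLeaf : (Fin n → ℕ) → Fin n → Bool
isLeaf π i = π i ≡ᵇ 1

OtherNonNbr : Graph n → Fin n → Fin n → Bool
OtherNonNbr G v i = not (adj G v i) ∧ not ⌊ i ≟ v ⌋

LeafNonNbr NonLeafNonNbr : (Fin n → ℕ) → Graph n → Fin n → Fin n → Bool
LeafNonNbr    π G v i = OtherNonNbr G v i ∧ isLeaf π i
NonLeafNonNbr π G v i = OtherNonNbr G v i ∧ not (isLeaf π i)

NoLeafNbr : Graph n → (Fin n → ℕ) → Fin n → Set
NoLeafNbr G π v = ∀ u → adj G v u ≡ true → π u ≡ 1 → ⊥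

nonLeafNonNbr : (G : Graph n) (π : Fin n → ℕ) {v w : Fin n} →
  adj G v w ≡ false → ¬ w ≡ v → ¬ π w ≡ 1 → NonLeafNonNbr π G v w ≡ true
nonLeafNonNbr G π {v} {w} vw w≢v w-nonleaf
  rewrite vw
        | ⌊≟⌋-false w≢v
        | ¬-not {y = true} (w-nonleaf ∘ ≡ᵇ-true⇒≡ (π w) 1) = refl

vertex-partition : (G : Graph n) (v : Fin n) → deg G v + suc (count (OtherNonNbr G v)) ≡ n
vertex-partition {n} G v = begin
  deg G v + suc c                              ≡⟨ cong (deg G v +_) (+-comm 1 c) ⟩
  deg G v + (c + ind (not false))              ≡⟨ cong (λ b → deg G v + (c + ind (not b))) (sym (irrefl G v)) ⟩
  deg G v + (c + ind (not (adj G v v)))        ≡⟨ cong (deg G v +_) (count-remove (not ∘ adj G v) v) ⟩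
  deg G v + count (not ∘ adj G v)              ≡⟨ sym (count-split (λ _ → true) (adj G v)) ⟩
  count {n} (λ _ → true)                       ≡⟨ count-all ⟩
  n                                            ∎
  where
  open ≡-Reasoning
  c : ℕ
  c = count (OtherNonNbr G v)

-- Without leaf neighbours, every leaf other than v is a non-neighbour of v.
leaves-bound : (G : Graph n) (π : Fin n → ℕ) (v : Fin n) → NoLeafNbr G π v →
  kappa1 π ≤ count (LeafNonNbr π G v) + ind (isLeaf π v)
leaves-bound G π v noLeafNbr =
  subst (_≤ count (LeafNonNbr π G v) + ind (isLeaf π v)) (count-remove (isLeaf π) v)
    (+-monoˡ-≤ (ind (isLeaf π v)) (count-mono _ (LeafNonNbr π G v) leaf⇒nonNbr))
  where
  leaf⇒nonNbr : ∀ i → (isLeaf π i ∧ not ⌊ i ≟ v ⌋) ≡ true → LeafNonNbr π G v i ≡ true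
  leaf⇒nonNbr i e with (leaf , other) ← ∧-true {isLeaf π i} e
    rewrite leaf | other
          | ¬-not {y = true} (λ vi → noLeafNbr i vi (≡ᵇ-true⇒≡ (π i) 1 leaf)) = refl

cancel-bound : ∀ d L S c x k → d + suc (L + S) ≤ d + k + x → k ≤ L + c → suc S ≤ c + x
cancel-bound d L S c x k size k≤ = +-cancelˡ-≤ L _ _ (+-cancelˡ-≤ d _ _ (begin
  d + (L + suc S)    ≡⟨ cong (d +_) (+-suc L S) ⟩
  d + suc (L + S)    ≤⟨ size ⟩
  d + k + x          ≤⟨ +-monoˡ-≤ x (+-monoʳ-≤ d k≤) ⟩
  d + (L + c) + x    ≡⟨ +-assoc d (L + c) x ⟩
  d + (L + c + x)    ≡⟨ cong (d +_) (+-assoc L c x) ⟩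
  d + (L + (c + x))  ∎))
  where open ℕₚ.≤-Reasoning

nonLeafNonNbr-bound : (G : Graph n) (π : Fin n → ℕ) (v : Fin n) {d : ℕ} →
  Realizes G π → NoLeafNbr G π v → π v ≡ d → n ≤ d + kappa1 π + xval π →
  suc (count (NonLeafNonNbr π G v)) ≤ ind (d ≡ᵇ 1) + xval π
nonLeafNonNbr-bound {n} G π v {d} real noLeafNbr πv≡d bound =
  cancel-bound d L S (ind (d ≡ᵇ 1)) (xval π) (kappa1 π)
    (subst (_≤ d + kappa1 π + xval π) size bound)
    (subst (λ m → kappa1 π ≤ L + ind (m ≡ᵇ 1)) πv≡d (leaves-bound G π v noLeafNbr))
  where
  open ≡-Reasoning
  L S : ℕ
  L = count (LeafNonNbr π G v)
  S = count (NonLeafNonNbr π G v)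
  size : n ≡ d + suc (L + S)
  size = begin
    n                                       ≡⟨ sym (vertex-partition G v) ⟩
    deg G v + suc (count (OtherNonNbr G v)) ≡⟨ cong₂ (λ a b → a + suc b) (trans (real v) πv≡d)
                                                     (count-split (OtherNonNbr G v) (isLeaf π)) ⟩
    d + suc (L + S)                         ∎

xval≤1 : (π : Fin n → ℕ) → xval π ≤ 1
xval≤1 π with count (λ j → π j ≡ᵇ 2) ≡ᵇ 0
... | true  = s≤s z≤n
... | false = z≤n

two⇒xval≡0 : (π : Fin n → ℕ) (i : Fin n) → π i ≡ 2 → xval π ≡ 0
two⇒xval≡0 π i two
  with count (λ j → π j ≡ᵇ 2) | count-pos (λ j → π j ≡ᵇ 2) i (cong (_≡ᵇ 2) two)
... | suc _ | _ = refl

isolated-stepFree : (G : Graph n) (π : Fin n → ℕ) (v : Fin n) → deg G v ≡ 0 → StepFree G π v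
isolated-stepFree G π v isolated u _ vu _ _ _
  with () ← subst (1 ≤_) isolated (count-pos (adj G v) u vu)

leafNbr-stepFree : (G : Graph n) {π : Fin n → ℕ} {ℓ v : Fin n} → Realizes G π →
  π ℓ ≡ 1 → adj G ℓ v ≡ true → ¬ Bad π (π v) → StepFree G π ℓ
leafNbr-stepFree G real leaf ℓv good u w ℓu _ _ step
  with refl ← leaf-unique-nbr G real leaf ℓu ℓv = good (bad-step w step)

leafNonNbrs-stepFree : (G : Graph n) (π : Fin n → ℕ) (v : Fin n) →
  (∀ w → adj G v w ≡ false → ¬ w ≡ v → π w ≡ 1) → (∀ u → ¬ π u ≡ 2) → StepFree G π v
leafNonNbrs-stepFree G π v leaves no-two u w _ vw w≢v step =
  no-two u (trans step (cong suc (leaves w vw w≢v)))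

-- Case d ≥ 2: the bound 1 + S ≤ x forces S = 0 and x = 1.
crowded-stepFree : (G : Graph n) (π : Fin n → ℕ) (v : Fin n) →
  suc (count (NonLeafNonNbr π G v)) ≤ xval π → StepFree G π v
crowded-stepFree G π v few = leafNonNbrs-stepFree G π v leaves no-two
  where
  S≡0 : count (NonLeafNonNbr π G v) ≡ 0
  S≡0 = n≤0⇒n≡0 (s≤s⁻¹ (≤-trans few (xval≤1 π)))
  leaves : ∀ w → adj G v w ≡ false → ¬ w ≡ v → π w ≡ 1
  leaves w vw w≢v with π w ℕₚ.≟ 1
  ... | yes w-leaf = w-leaf
  ... | no w-nonleaf with () ← subst (1 ≤_) S≡0
                                 (count-pos _ w (nonLeafNonNbr G π vw w≢v w-nonleaf))
  no-two : ∀ u → ¬ π u ≡ 2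
  no-two u two with () ← subst (1 ≤_) (two⇒xval≡0 π u two) (≤-trans (s≤s z≤n) few)

-- If at most x vertices satisfy q, a q-vertex u has no degree step π u = π w + 1
-- down to a vertex w that is a leaf (forcing an entry 2, so x = 0) or else
-- another q-vertex (so two q-vertices, while x ≤ 1).
few-no-step : (π : Fin n → ℕ) (q : Fin n → Bool) {u w : Fin n} → count q ≤ xval π →
  q u ≡ true → π u ≡ suc (π w) → (¬ π w ≡ 1 → q w ≡ true) → ⊥
few-no-step π q {u} {w} few qu step qw with π w ℕₚ.≟ 1
... | yes w-leaf with () ← subst (1 ≤_) (two⇒xval≡0 π u (trans step (cong suc w-leaf)))
                                  (≤-trans (count-pos q u qu) few)
... | no w-nonleaf with s≤s () ← ≤-trans (count-two q u w qu (qw w-nonleaf) (step⇒≢ step))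
                                          (≤-trans few (xval≤1 π))

leafEndpoint-stepFree : (G : Graph n) (π : Fin n → ℕ) {v p : Fin n} → Realizes G π →
  π v ≡ 1 → ¬ Bad π 1 → adj G v p ≡ true →
  count (NonLeafNonNbr π G v) ≤ xval π → StepFree G π p
leafEndpoint-stepFree G π {v} {p} real leaf good vp few u w pu pw w≢p step with u ≟ v
... | yes refl = good (subst (Bad π) leaf (bad-step w step))
... | no u≢v = few-no-step π (NonLeafNonNbr π G v) few u∈S step w∈S
  where
  -- the only neighbour of v is p, and neither u nor w equals p
  off-v : ∀ {x} → ¬ x ≡ p → adj G v x ≡ false
  off-v x≢p = ¬-not {y = true} (x≢p ∘ λ vx → leaf-unique-nbr G real leaf vx vp)
  w≢v : ¬ w ≡ v
  w≢v refl with () ← trans (sym (trans (Graph.sym G p v) vp)) pw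
  u∈S : NonLeafNonNbr π G v u ≡ true
  u∈S = nonLeafNonNbr G π (off-v (adj⇒≢ G pu)) u≢v
          (λ u-leaf → good (subst (Bad π) u-leaf (bad-step w step)))
  w∈S : ¬ π w ≡ 1 → NonLeafNonNbr π G v w ≡ true
  w∈S = nonLeafNonNbr G π (off-v w≢p) w≢v

noLeafNbr-stepFree : (G : Graph n) (π : Fin n → ℕ) (v : Fin n) {d : ℕ} →
  Realizes G π → π v ≡ d → ¬ Bad π d →
  suc (count (NonLeafNonNbr π G v)) ≤ ind (d ≡ᵇ 1) + xval π → ∃ (StepFree G π)
noLeafNbr-stepFree G π v {zero} real πv≡0 _ _ =
  v , isolated-stepFree G π v (trans (real v) πv≡0)
noLeafNbr-stepFree G π v {suc zero} real πv≡1 good few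
  with (p , vp) ← leaf-nbr G real v πv≡1 =
  p , leafEndpoint-stepFree G π real πv≡1 good vp (s≤s⁻¹ few)
noLeafNbr-stepFree G π v {suc (suc _)} _ _ _ few = v , crowded-stepFree G π v few

stepFree-vertex : (G : Graph n) (π : Fin n → ℕ) (v : Fin n) {d : ℕ} →
  Realizes G π → π v ≡ d → ¬ Bad π d → n ≤ d + kappa1 π + xval π → ∃ (StepFree G π)
stepFree-vertex G π v real πv≡d good bound
  with any? (λ u → (adj G v u Boolₚ.≟ true) ×-dec (π u ℕₚ.≟ 1))
... | yes (ℓ , vℓ , leaf) =
  ℓ , leafNbr-stepFree G real leaf (trans (Graph.sym G ℓ v) vℓ) (subst (¬_ ∘ Bad π) (sym πv≡d) good)
... | no noLeaf = noLeafNbr-stepFree G π v real πv≡d good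
  (nonLeafNonNbr-bound G π v real (λ u vu leaf → noLeaf (u , vu , leaf)) πv≡d bound)

mainTheorem14 : (n : ℕ) (π : Fin n → ℕ) (d : ℕ) →
    GoodEntry π d → n ≤ d + kappa1 π + xval π →
    DsReconstructionForcing π
mainTheorem14 n π d ((v , πv≡d) , good) bound G real
  with (u , free) ← stepFree-vertex G π v real πv≡d good bound =
  u , stepFree⇒completable G π u real free
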